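{- Let $G$ be a connected graph of order $n\geq 3$ with minimum degree $\delta(G)\geq 2$. If $\gamma_{t[1,2]}(G)<+\infty$, then $\gamma_{t[1,2]}(G)\leq \frac{2n}{3}$.
   Context: All graphs are finite, simple and undirected; $N(v)$ denotes the neighborhood of $v$. A set $S\subseteq V(G)$ is a total $[1,2]$-set of $G$ if $1\leq |N(v)\cap S|\leq 2$ for every vertex $v\in V(G)$. $\gamma_{t[1,2]}(G)$ is the minimum cardinality of a total $[1,2]$-set of $G$, with $\gamma_{t[1,2]}(G)=+\infty$ if no such set exists. -}

module Defs where

open import Data.Nat using (ℕ; zero; suc; _+_; _*_; _≤_)
open import Data.Bool using (Bool; true; false; _∧_; if_then_else_)
open import Data.Fin using (Fin)
open import Data.Fin.Subset using (Subset; _∈_; ∣_∣)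
open import Data.Vec using (lookup)
open import Data.Product using (_×_; Σ; ∃)
open import Relation.Binary.PropositionalEquality using (_≡_)

record Graph (n : ℕ) : Set where
  field
    adj   : Fin n → Fin n → Bool
    sym   : ∀ u v → adj u v ≡ adj v u
    irrefl : ∀ v → adj v v ≡ false
open Graph public

count : ∀ {n} → (Fin n → Bool) → ℕ
count {zero}  f = 0
count {suc n} f = (if f Fin.zero then 1 else 0) + count (λ i → f (Fin.suc i))

degree : ∀ {n} → Graph n → Fin n → ℕ
degree G v = count (λ u → adj G v u)

nbInS : ∀ {n} → Graph n → Subset n → Fin n → ℕ
nbInS G S v = count (λ u → adj G v u ∧ lookup S u)

MinDegreeAtLeast : ∀ {n} → Graph n → ℕ → Set
MinDegreeAtLeast G k = ∀ v → k ≤ degree G v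

data Walk {n} (G : Graph n) : Fin n → Fin n → Set where
  here : ∀ {v} → Walk G v v
  step : ∀ {u w v} → adj G u w ≡ true → Walk G w v → Walk G u v

Connected : ∀ {n} → Graph n → Set
Connected G = ∀ u v → Walk G u v

IsTotal12Set : ∀ {n} → Graph n → Subset n → Set
IsTotal12Set G S = ∀ v → 1 ≤ nbInS G S v × nbInS G S v ≤ 2

HasTotal12Set : ∀ {n} → Graph n → Set
HasTotal12Set G = Σ _ (IsTotal12Set G)

-- 3 · γ_{t[1,2]}(G) ≤ m, i.e. γ_{t[1,2]}(G) ≤ m/3 (exact rational comparison)
γt12≤3 : ∀ {n} → Graph n → ℕ → Set
γt12≤3 G m = Σ _ (λ S → IsTotal12Set G S × 3 * ∣ S ∣ ≤ m)

module Submission where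

-- Shrink a total [1,2]-set S until every s ∈ S has an open private neighbour, i.e. a vertex whose
-- only neighbour in S is s: a vertex of S without one can be deleted. Then charge every s ∈ S to a
-- vertex outside S, namely to a neighbour of s outside S if there is one, and otherwise to the private
-- neighbour p of the private neighbour v of s; p ∉ S since otherwise p = s would have degree 1.
-- A vertex x ∉ S is charged at most twice: by its two neighbours in S, or, if it has only one, w,
-- by w and by the unique neighbour of w in S. Hence |S| ≤ 2 |V ∖ S|, i.e. 3 |S| ≤ 2n.

open import Defs hiding (sym)
open import Data.Nat.Properties hiding (_≟_; 0≢1+n; suc-injective)
open import Data.Nat.Properties as ℕ using ()
open import Algebra.Properties.Semiring.Sum +-*-semiring
  using (sum; sum-syntax; sum-cong-≗; ∑-comm; *-distribˡ-sum)
open import Data.Bool using (Bool; true; false; T; _∧_; not; if_then_else_)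
open import Data.Bool.Properties using (T?; T-∧; T-≡; ∧-assoc; ∧-identityʳ; ∧-zeroʳ)
open import Data.Empty using (⊥-elim)
open import Data.Fin using (Fin; zero; suc)
open import Data.Fin.Properties using (_≟_; any?; 0≢1+n; suc-injective)
open import Data.Fin.Subset using (Subset; ∣_∣)
open import Data.Nat using (ℕ; zero; suc; _+_; _*_; _≤_; _<_; z≤n; s≤s)
open import Data.Nat.Induction using (<-wellFounded)
open import Data.Product using (_×_; Σ; ∃; _,_; proj₁; proj₂)
open import Data.Sum using (_⊎_; inj₁; inj₂)
open import Data.Vec using ([]; _∷_; lookup; tabulate)
open import Data.Vec.Properties using (lookup∘tabulate)
open import Function using (_∘_; Equivalence)
open import Induction.WellFounded using (Acc; acc)
open import Relation.Nullary using (Dec; ¬_; yes; no; does; contradiction)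
open import Relation.Nullary.Decidable
  using (⌊_⌋; _×-dec_; _⊎-dec_; ¬?; dec-true; dec-false; toWitness; fromWitness; decidable-stable)
open import Relation.Binary.PropositionalEquality

iverson : Bool → ℕ
iverson b = if b then 1 else 0

iverson-mono : ∀ {a b} → (T a → T b) → iverson a ≤ iverson b
iverson-mono {false}         _   = z≤n
iverson-mono {true}  {true}  _   = ≤-refl
iverson-mono {true}  {false} a⇒b = ⊥-elim (a⇒b _)

iverson-T : ∀ {b} → T b → iverson b ≡ 1
iverson-T {true} _ = refl

iverson≤1 : ∀ b → iverson b ≤ 1
iverson≤1 true  = ≤-refl
iverson≤1 false = z≤n

∑-mono-≤ : ∀ {m} {f g : Fin m → ℕ} → (∀ i → f i ≤ g i) → sum f ≤ sum g
∑-mono-≤ {zero}  _   = z≤n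
∑-mono-≤ {suc m} f≤g = +-mono-≤ (f≤g zero) (∑-mono-≤ (f≤g ∘ suc))

count≡∑ : ∀ {n} (p : Fin n → Bool) → count p ≡ ∑[ i < n ] iverson (p i)
count≡∑ {zero}  p = refl
count≡∑ {suc n} p = cong (iverson (p zero) +_) (count≡∑ (p ∘ suc))

count-cong : ∀ {n} {p q : Fin n → Bool} → (∀ i → p i ≡ q i) → count p ≡ count q
count-cong {p = p} {q} p≗q = trans (count≡∑ p) (trans (sum-cong-≗ (cong iverson ∘ p≗q)) (sym (count≡∑ q)))

count-mono : ∀ {n} {p q : Fin n → Bool} → (∀ i → T (p i) → T (q i)) → count p ≤ count q
count-mono {p = p} {q} p⊆q = begin
  count p                  ≡⟨ count≡∑ p ⟩
  sum (iverson ∘ p)        ≤⟨ ∑-mono-≤ (iverson-mono ∘ p⊆q) ⟩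
  sum (iverson ∘ q)        ≡⟨ count≡∑ q ⟨
  count q                  ∎
  where open ≤-Reasoning

count-false : ∀ {n} {p : Fin n → Bool} → (∀ i → ¬ T (p i)) → count p ≡ 0
count-false {zero}          _     = refl
count-false {suc n} {p} ¬p with p zero | ¬p zero
... | true  | ¬p₀ = ⊥-elim (¬p₀ _)
... | false | _   = count-false (¬p ∘ suc)

count-+-count-not : ∀ {n} (p : Fin n → Bool) → count p + count (not ∘ p) ≡ n
count-+-count-not {zero}  p = refl
count-+-count-not {suc n} p with p zero
... | true  = cong suc (count-+-count-not (p ∘ suc))
... | false = trans (+-suc _ _) (cong suc (count-+-count-not (p ∘ suc)))

count-≥1 : ∀ {n} (p : Fin n → Bool) i → T (p i) → 1 ≤ count p
count-≥1 p zero    pᵢ with p zero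
... | true  = s≤s z≤n
... | false = ⊥-elim pᵢ
count-≥1 p (suc i) pᵢ = ≤-trans (count-≥1 (p ∘ suc) i pᵢ) (m≤n+m _ (iverson (p zero)))

count-witness : ∀ {n} (p : Fin n → Bool) → 1 ≤ count p → ∃ (T ∘ p)
count-witness {suc n} p c≥1 with p zero in p₀
... | true  = zero , subst T (sym p₀) _
... | false with count-witness (p ∘ suc) c≥1
...   | i , pᵢ = suc i , pᵢ

count-remove : ∀ {n} (p : Fin n → Bool) i → count p ≡ count (λ u → p u ∧ not (does (i ≟ u))) + iverson (p i)
count-remove p zero rewrite ∧-zeroʳ (p zero) | count-cong (∧-identityʳ ∘ p ∘ suc) = +-comm (iverson (p zero)) _
count-remove p (suc i) rewrite ∧-identityʳ (p zero) =
  trans (cong (iverson (p zero) +_) (count-remove (p ∘ suc) i)) (sym (+-assoc (iverson (p zero)) _ _))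

count≡1⇒unique : ∀ {n} (p : Fin n → Bool) {a b} → count p ≡ 1 → T (p a) → T (p b) → a ≡ b
count≡1⇒unique {n} p {a} {b} c≡1 pa pb with a ≟ b
... | yes a≡b = a≡b
... | no  a≢b = contradiction c≡1 (>⇒≢ (begin-strict
  1                            <⟨ +-monoˡ-≤ 1 (count-≥1 p∖a b pb∖a) ⟩
  count p∖a + 1                ≡⟨ cong (count p∖a +_) (iverson-T pa) ⟨
  count p∖a + iverson (p a)    ≡⟨ count-remove p a ⟨
  count p                      ∎))
  where
  open ≤-Reasoning
  p∖a : Fin n → Bool
  p∖a u = p u ∧ not (does (a ≟ u))
  pb∖a : T (p∖a b)
  pb∖a rewrite dec-false (a ≟ b) a≢b = Equivalence.from T-∧ (pb , _)

count-≤1 : ∀ {n} (p : Fin n → Bool) → (∀ a b → T (p a) → T (p b) → a ≡ b) → count p ≤ 1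
count-≤1 {zero}  p _   = z≤n
count-≤1 {suc n} p sub with p zero in p₀
... | true  = ≤-reflexive (cong suc (count-false (λ i pᵢ → 0≢1+n (sub zero (suc i) (subst T (sym p₀) _) pᵢ))))
... | false = count-≤1 (p ∘ suc) (λ a b pa pb → suc-injective (sub (suc a) (suc b) pa pb))

count≤*count : ∀ {k m} (g : Fin k → Bool) (q : Fin m → Bool) (r : Fin k → Fin m → Bool) c →
  (∀ s → T (g s) → ∃ λ x → T (q x) × T (r s x)) →
  (∀ x → T (q x) → count (λ s → g s ∧ r s x) ≤ c) →
  count g ≤ c * count q
count≤*count {k} {m} g q r c covered bounded = begin
  count g                                              ≡⟨ count≡∑ g ⟩
  ∑[ s < k ] iverson (g s)                             ≤⟨ ∑-mono-≤ cover ⟩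
  ∑[ s < k ] ∑[ x < m ] iverson (q x ∧ (g s ∧ r s x))  ≡⟨ ∑-comm (λ s x → iverson (q x ∧ (g s ∧ r s x))) ⟩
  ∑[ x < m ] ∑[ s < k ] iverson (q x ∧ (g s ∧ r s x))  ≡⟨ sum-cong-≗ (λ x → count≡∑ (fibre x)) ⟨
  ∑[ x < m ] count (fibre x)                           ≤⟨ ∑-mono-≤ fibre-bound ⟩
  ∑[ x < m ] (c * iverson (q x))                       ≡⟨ *-distribˡ-sum c (iverson ∘ q) ⟨
  c * (∑[ x < m ] iverson (q x))                       ≡⟨ cong (c *_) (count≡∑ q) ⟨
  c * count q                                          ∎
  where
  open ≤-Reasoning
  fibre : Fin m → Fin k → Bool
  fibre x s = q x ∧ (g s ∧ r s x)

  cover : ∀ s → iverson (g s) ≤ ∑[ x < m ] iverson (fibre x s)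
  cover s = ≤-trans (covered-once s) (≤-reflexive (count≡∑ (λ x → fibre x s)))
    where
    covered-once : ∀ s → iverson (g s) ≤ count (λ x → fibre x s)
    covered-once s with g s in gₛ
    ... | false = z≤n
    ... | true with covered s (subst T (sym gₛ) _)
    ...   | x , qₓ , rₛₓ = count-≥1 _ x (Equivalence.from T-∧ (qₓ , rₛₓ))

  fibre-bound : ∀ x → count (fibre x) ≤ c * iverson (q x)
  fibre-bound x with q x | bounded x
  ... | true  | bound = ≤-trans (bound _) (≤-reflexive (sym (*-identityʳ c)))
  ... | false | _     = ≤-trans (≤-reflexive (count-false {k} {λ _ → false} (λ _ ()))) z≤n

∣S∣≡count : ∀ {n} (S : Subset n) → ∣ S ∣ ≡ count (lookup S)
∣S∣≡count []          = refl
∣S∣≡count (true  ∷ S) = cong suc (∣S∣≡count S)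
∣S∣≡count (false ∷ S) = ∣S∣≡count S

_∖_ : ∀ {n} → Subset n → Fin n → Subset n
S ∖ s = tabulate (λ u → lookup S u ∧ not (does (s ≟ u)))

size-∖ : ∀ {n} (S : Subset n) {s} → T (lookup S s) → count (lookup S) ≡ suc (count (lookup (S ∖ s)))
size-∖ S {s} s∈S = begin
  count (lookup S)                                ≡⟨ count-remove (lookup S) s ⟩
  count (λ u → S∖s u) + iverson (lookup S s)      ≡⟨ cong₂ _+_ (count-cong (sym ∘ lookup∘tabulate S∖s)) (iverson-T s∈S) ⟩
  count (lookup (S ∖ s)) + 1                      ≡⟨ +-comm _ 1 ⟩
  suc (count (lookup (S ∖ s)))                    ∎
  where
  open ≡-Reasoning
  S∖s : Fin _ → Bool
  S∖s u = lookup S u ∧ not (does (s ≟ u))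

m≤2n⇒3m≤2[m+n] : ∀ {m n} → m ≤ 2 * n → 3 * m ≤ 2 * (m + n)
m≤2n⇒3m≤2[m+n] {m} {n} m≤2n = begin
  m + 2 * m      ≤⟨ +-monoˡ-≤ (2 * m) m≤2n ⟩
  2 * n + 2 * m  ≡⟨ +-comm (2 * n) (2 * m) ⟩
  2 * m + 2 * n  ≡⟨ *-distribˡ-+ 2 m n ⟨
  2 * (m + n)    ∎
  where open ≤-Reasoning

module _ {n : ℕ} (G : Graph n) where

  adj-sym : ∀ {u v} → T (adj G u v) → T (adj G v u)
  adj-sym {u} {v} = subst T (Graph.sym G u v)

  module _ (S : Subset n) where

    nbInS-∖ : ∀ {s} v → T (lookup S s) → nbInS G S v ≡ nbInS G (S ∖ s) v + iverson (adj G v s)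
    nbInS-∖ {s} v s∈S =
      trans (count-remove (λ u → adj G v u ∧ lookup S u) s)
            (cong₂ _+_ (count-cong reassociate) (cong iverson drop-s∈S))
      where
      reassociate : ∀ u → (adj G v u ∧ lookup S u) ∧ not (does (s ≟ u)) ≡ adj G v u ∧ lookup (S ∖ s) u
      reassociate u = trans (∧-assoc (adj G v u) (lookup S u) _) (cong (adj G v u ∧_) (sym (lookup∘tabulate _ u)))
      drop-s∈S : adj G v s ∧ lookup S s ≡ adj G v s
      drop-s∈S rewrite Equivalence.to T-≡ s∈S = ∧-identityʳ _

    nbInS≡1⇒unique : ∀ {x a b} → nbInS G S x ≡ 1 →
      T (adj G x a) → T (lookup S a) → T (adj G x b) → T (lookup S b) → a ≡ b
    nbInS≡1⇒unique {x} N[x]≡1 x~a a∈S x~b b∈S =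
      count≡1⇒unique (λ u → adj G x u ∧ lookup S u) N[x]≡1
        (Equivalence.from T-∧ (x~a , a∈S)) (Equivalence.from T-∧ (x~b , b∈S))

    nbInS≡degree : ∀ {s} → (∀ u → T (adj G s u) → T (lookup S u)) → nbInS G S s ≡ degree G s
    nbInS≡degree {s} N[s]⊆S = count-cong pointwise
      where
      pointwise : ∀ u → adj G s u ∧ lookup S u ≡ adj G s u
      pointwise u with adj G s u | N[s]⊆S u
      ... | false | _   = refl
      ... | true  | u∈S = Equivalence.to T-≡ (u∈S _)

    PrivateNeighbour : Fin n → Fin n → Set
    PrivateNeighbour s v = T (adj G v s) × nbInS G S v ≡ 1

    privateNeighbour? : ∀ s v → Dec (PrivateNeighbour s v)
    privateNeighbour? s v = T? (adj G v s) ×-dec (nbInS G S v ℕ.≟ 1)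

    OpenIrredundant : Set
    OpenIrredundant = ∀ s → T (lookup S s) → ∃ (PrivateNeighbour s)

    removable : ∀ {s} → IsTotal12Set G S → T (lookup S s) → (∀ v → ¬ PrivateNeighbour s v) →
      IsTotal12Set G (S ∖ s)
    removable {s} total s∈S none v with adj G v s in v~s | nbInS-∖ {s} v s∈S
    ... | false | N≡N′+0 = subst (λ k → 1 ≤ k × k ≤ 2) (trans N≡N′+0 (+-identityʳ _)) (total v)
    ... | true  | N≡N′+1 = n≢0⇒n>0 N′≢0 , ≤-trans (m≤m+n _ 1) (subst (_≤ 2) N≡N′+1 (proj₂ (total v)))
      where
      N′≢0 : nbInS G (S ∖ s) v ≢ 0
      N′≢0 N′≡0 = none v (subst T (sym v~s) _ , trans N≡N′+1 (cong (_+ 1) N′≡0))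

    Partner : Fin n → Fin n → Set
    Partner s x = T (adj G s x) ⊎ ∃ λ v → T (lookup S v) × PrivateNeighbour v x × PrivateNeighbour s v

    partner? : ∀ s x → Dec (Partner s x)
    partner? s x =
      T? (adj G s x) ⊎-dec any? (λ v → T? (lookup S v) ×-dec privateNeighbour? v x ×-dec privateNeighbour? s v)

    partner-via-private-neighbours : ∀ {s} → MinDegreeAtLeast G 2 → OpenIrredundant → T (lookup S s) →
      (∀ u → T (adj G s u) → T (lookup S u)) → ∃ λ x → T (not (lookup S x)) × Partner s x
    partner-via-private-neighbours {s} δ irr s∈S N[s]⊆S with irr s s∈S
    ... | v , v~s , N[v]≡1 with irr v (N[s]⊆S v (adj-sym v~s))
    ...   | p , p~v , N[p]≡1 = p , p∉S , inj₂ (v , N[s]⊆S v (adj-sym v~s) , (p~v , N[p]≡1) , (v~s , N[v]≡1))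
      where
      p∉S : T (not (lookup S p))
      p∉S with lookup S p in p∈S
      ... | false = _
      ... | true  = 1+n≰n (subst (2 ≤_) deg[s]≡1 (δ s))
        where
        p≡s : p ≡ s
        p≡s = nbInS≡1⇒unique N[v]≡1 (adj-sym p~v) (subst T (sym p∈S) _) v~s s∈S
        deg[s]≡1 : degree G s ≡ 1
        deg[s]≡1 = trans (sym (nbInS≡degree N[s]⊆S)) (subst (λ u → nbInS G S u ≡ 1) p≡s N[p]≡1)

    outside-partner : ∀ {s} → MinDegreeAtLeast G 2 → OpenIrredundant → T (lookup S s) →
      ∃ λ x → T (not (lookup S x)) × Partner s x
    outside-partner {s} δ irr s∈S with any? (λ u → T? (adj G s u) ×-dec T? (not (lookup S u)))
    ... | yes (u , s~u , u∉S) = u , u∉S , inj₁ s~u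
    ... | no  no-outside = partner-via-private-neighbours δ irr s∈S N[s]⊆S
      where
      N[s]⊆S : ∀ u → T (adj G s u) → T (lookup S u)
      N[s]⊆S u s~u with lookup S u in u∈S
      ... | true  = _
      ... | false = no-outside (u , s~u , subst (T ∘ not) (sym u∈S) _)

    partnersOf : Fin n → Fin n → Bool
    partnersOf x s = lookup S s ∧ ⌊ partner? s x ⌋

    partners≤2-when-nbInS≡2 : ∀ {x} → nbInS G S x ≡ 2 → count (partnersOf x) ≤ 2
    partners≤2-when-nbInS≡2 {x} N[x]≡2 =
      ≤-trans (count-mono {q = λ s → adj G x s ∧ lookup S s} into-N[x]) (≤-reflexive N[x]≡2)
      where
      into-N[x] : ∀ s → T (partnersOf x s) → T (adj G x s ∧ lookup S s)
      into-N[x] s h with Equivalence.to T-∧ h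
      ... | s∈S , P with toWitness {a? = partner? s x} P
      ...   | inj₁ s~x                          = Equivalence.from T-∧ (adj-sym s~x , s∈S)
      ...   | inj₂ (_ , _ , (_ , N[x]≡1) , _) = contradiction (trans (sym N[x]≡2) N[x]≡1) λ ()

    partners≤2-when-nbInS≡1 : ∀ {x} → nbInS G S x ≡ 1 → count (partnersOf x) ≤ 2
    partners≤2-when-nbInS≡1 {x} N[x]≡1 with count-witness (λ u → adj G x u ∧ lookup S u) (≤-reflexive (sym N[x]≡1))
    ... | w , x~w∈S = begin
      count F                                  ≡⟨ count-remove F w ⟩
      count F∖w + iverson (F w)                ≤⟨ +-mono-≤ (count-≤1 F∖w F∖w-unique) (iverson≤1 (F w)) ⟩
      1 + 1                                    ∎
      where
      open ≤-Reasoning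
      F F∖w : Fin n → Bool
      F = partnersOf x
      F∖w s = F s ∧ not (does (w ≟ s))

      ≡w : ∀ {v} → T (adj G x v) → T (lookup S v) → v ≡ w
      ≡w x~v v∈S = nbInS≡1⇒unique N[x]≡1 x~v v∈S (proj₁ (Equivalence.to T-∧ x~w∈S)) (proj₂ (Equivalence.to T-∧ x~w∈S))

      F∖w⇒private : ∀ s → T (F∖w s) → T (lookup S s) × PrivateNeighbour s w
      F∖w⇒private s h with Equivalence.to T-∧ h
      ... | Fs , w≢s with Equivalence.to T-∧ Fs
      ...   | s∈S , P with toWitness {a? = partner? s x} P
      ...     | inj₁ s~x = ⊥-elim (subst (λ b → T (not b)) (dec-true (w ≟ s) (sym (≡w (adj-sym s~x) s∈S))) w≢s)
      ...     | inj₂ (v , v∈S , (x~v , _) , s-private) = s∈S , subst (PrivateNeighbour s) (≡w x~v v∈S) s-private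

      F∖w-unique : ∀ s t → T (F∖w s) → T (F∖w t) → s ≡ t
      F∖w-unique s t hₛ hₜ with F∖w⇒private s hₛ | F∖w⇒private t hₜ
      ... | s∈S , w~s , N[w]≡1 | t∈S , w~t , _ = nbInS≡1⇒unique N[w]≡1 w~s s∈S w~t t∈S

    partners≤2 : IsTotal12Set G S → ∀ x → count (partnersOf x) ≤ 2
    partners≤2 total x with nbInS G S x ℕ.≟ 2
    ... | yes N[x]≡2 = partners≤2-when-nbInS≡2 N[x]≡2
    ... | no  N[x]≢2 = partners≤2-when-nbInS≡1 (≤-antisym (≤-pred (≤∧≢⇒< (proj₂ (total x)) N[x]≢2)) (proj₁ (total x)))

    open-irredundant⇒∣S∣≤2∣∁S∣ : MinDegreeAtLeast G 2 → IsTotal12Set G S → OpenIrredundant →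
      count (lookup S) ≤ 2 * count (not ∘ lookup S)
    open-irredundant⇒∣S∣≤2∣∁S∣ δ total irr =
      count≤*count (lookup S) (not ∘ lookup S) (λ s x → ⌊ partner? s x ⌋) 2
        has-partner (λ x _ → partners≤2 total x)
      where
      has-partner : ∀ s → T (lookup S s) → ∃ λ x → T (not (lookup S x)) × T ⌊ partner? s x ⌋
      has-partner s s∈S with outside-partner δ irr s∈S
      ... | x , x∉S , P = x , x∉S , fromWitness P

  open-irredundant-total12-set : ∀ S → IsTotal12Set G S →
    Σ (Subset n) λ S′ → IsTotal12Set G S′ × OpenIrredundant S′
  open-irredundant-total12-set S = shrink S (<-wellFounded _)
    where
    shrink : ∀ S → Acc _<_ (count (lookup S)) → IsTotal12Set G S →
      Σ (Subset n) λ S′ → IsTotal12Set G S′ × OpenIrredundant S′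
    shrink S (acc smaller) total with any? (λ s → T? (lookup S s) ×-dec ¬? (any? (privateNeighbour? S s)))
    ... | yes (s , s∈S , none) =
      shrink (S ∖ s) (smaller (≤-reflexive (sym (size-∖ S s∈S))))
        (removable S total s∈S (λ v pn → none (v , pn)))
    ... | no all-private =
      S , total , λ s s∈S → decidable-stable (any? (privateNeighbour? S s)) (λ none → all-private (s , s∈S , none))

theorem2p5 : (n : ℕ) → 3 ≤ n → (G : Graph n) → Connected G → MinDegreeAtLeast G 2 →
    HasTotal12Set G → γt12≤3 G (2 * n)
theorem2p5 n _ G _ δ (S₀ , total₀) with open-irredundant-total12-set G S₀ total₀
... | S , total , irr = S , total , subst (λ k → 3 * k ≤ 2 * n) (sym (∣S∣≡count S)) (begin
  3 * count (lookup S)                              ≤⟨ m≤2n⇒3m≤2[m+n] (open-irredundant⇒∣S∣≤2∣∁S∣ G S δ total irr) ⟩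
  2 * (count (lookup S) + count (not ∘ lookup S))   ≡⟨ cong (2 *_) (count-+-count-not (lookup S)) ⟩
  2 * n                                             ∎)
  where open ≤-Reasoning
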